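{- For integers $n$ and $k\ge 1$, let $B(n;k)$ denote the number of sequences $(a_k,a_{k-1},\dots,a_1)\in\{ -1,0,1\}^k$ such that $\sum_{i=1}^k a_iF_i=n$, where $F_i$ is the $i$-th Fibonacci number ($F_1=F_2=1$, $F_i=F_{i-1}+F_{i-2}$ for $i\ge 3$). Then \[ B(0;k+1)=B(0;k)+B(0;k-1)+B(0;k-2)\qquad\text{for all } k\ge 3, \] with $B(0;1)=1$, $B(0;2)=3$, and $B(0;3)=5$.
   Context: A representation of length $k$ is a sequence of digits $(a_k,\dots,a_1)$ with each $a_i\in\{1,0,-1\}$, representing the integer $\sum_{i=1}^k a_iF_i$; the length is $k$ even if $a_k=0$. Note that $F_1$ and $F_2$ are treated as distinct positions, so both may be used. -}

module Defs where

open import Data.Nat using (ℕ; zero; suc)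
open import Data.Integer using (ℤ; +_; -_; _+_; _*_; 0ℤ; 1ℤ)
import Data.Integer.Properties as ℤP
open import Data.List using (List; []; _∷_; map; concatMap; filter; length)
open import Data.Vec using (Vec; []; _∷_)
open import Relation.Binary.PropositionalEquality using (_≡_)
open import Relation.Nullary.Decidable using (Dec)

F : ℕ → ℕ
F zero = 0
F (suc zero) = 1
F (suc (suc i)) = F (suc i) Data.Nat.+ F i

digits : List ℤ
digits = 1ℤ ∷ 0ℤ ∷ (- 1ℤ) ∷ []

-- All sequences (a_k, ..., a_1) ∈ {-1,0,1}^k, head of the vector is a_k
allSeqs : (k : ℕ) → List (Vec ℤ k)
allSeqs zero = [] ∷ []
allSeqs (suc k) = concatMap (λ d → map (d ∷_) (allSeqs k)) digits

value : {k : ℕ} → Vec ℤ k → ℤ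
value [] = 0ℤ
value {suc k} (a ∷ as) = a * (+ F (suc k)) + value as

B : ℤ → ℕ → ℕ
B n k = length (filter (λ v → value v ℤP.≟ n) (allSeqs k))

{-# OPTIONS --safe #-}
-- Splitting off the leading digit gives
--   B(n; k+1) = B(n - F_{k+1}; k) + B(n; k) + B(n + F_{k+1}; k).
-- B(·; k) is even in n and vanishes from F_{k+2} on, since |Σ a_i F_i| ≤ F_{k+2} - 1.
-- Hence, with E_k = B(F_{k+1}; k), the case n = 0 gives B(0; k+1) = B(0; k) + 2 E_k,
-- and splitting twice the case n = F_{k+3} at length k+2 gives E_{k+2} = B(0; k) + E_k.
-- Eliminating E yields the recurrence.
module Submission where

open import Defs
open import Data.Bool using (true; false)
open import Data.Nat using (ℕ; _+_; _*_; _∸_; _≥_; _≤_; suc; zero; z≤n; s≤s)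
import Data.Nat.Properties as ℕP
open import Data.Nat.Tactic.RingSolver as ℕSolver using ()
open import Data.Integer as ℤ using (ℤ; +_; +[1+_]; -[1+_]; -_; _-_; 0ℤ; 1ℤ)
import Data.Integer.Properties as ℤP
open import Data.Integer.Tactic.RingSolver as ℤSolver using ()
open import Data.List using (List; []; _∷_; map; filter; length; _++_; concat)
open import Data.Nat.ListAction using (sum)
import Data.List.Properties as ListP
open import Data.Product using (_×_; _,_)
open import Data.Vec using (Vec; _∷_)
open import Function using (_∘_; _⇔_; mk⇔; Equivalence)
open import Relation.Binary.PropositionalEquality using (_≡_; refl; cong; cong₂; sym; trans; module ≡-Reasoning)
open import Relation.Nullary using (does)
open import Relation.Unary using (Pred; Decidable; _≐_)
open ≡-Reasoning

private
  variable
    k : ℕ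

filter-map : ∀ {a b p} {A : Set a} {B : Set b} {P : Pred B p} (P? : Decidable P) (f : A → B) (xs : List A) →
             filter P? (map f xs) ≡ map f (filter (P? ∘ f) xs)
filter-map P? f [] = refl
filter-map P? f (x ∷ xs) with does (P? (f x))
... | true  = cong (f x ∷_) (filter-map P? f xs)
... | false = filter-map P? f xs

+-≡⇔≡-minus : ∀ a x n → (a ℤ.+ x ≡ n) ⇔ (x ≡ n - a)
+-≡⇔≡-minus a x n = mk⇔ (λ a+x≡n → trans (x≡a+x-a a x) (cong (_- a) a+x≡n))
                         (λ x≡n-a → trans (cong (ℤ._+_ a) x≡n-a) (a+[n-a]≡n a n))
  where
  x≡a+x-a : ∀ a x → x ≡ a ℤ.+ x - a
  x≡a+x-a = ℤSolver.solve-∀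
  a+[n-a]≡n : ∀ a n → a ℤ.+ (n - a) ≡ n
  a+[n-a]≡n = ℤSolver.solve-∀

pos-minus-pos : ∀ {m n} → n ≤ m → + m - + n ≡ + (m ∸ n)
pos-minus-pos {m} {n} n≤m = trans (ℤP.m-n≡m⊖n m n) (ℤP.⊖-≥ n≤m)

F[n]≤F[1+n] : ∀ n → F n ≤ F (suc n)
F[n]≤F[1+n] zero          = z≤n
F[n]≤F[1+n] (suc zero)    = s≤s z≤n
F[n]≤F[1+n] (suc (suc n)) = ℕP.m≤m+n _ _

count : ℤ → List (Vec ℤ k) → ℕ
count n = length ∘ filter (λ v → value v ℤP.≟ n)

count-++ : ∀ n (xs ys : List (Vec ℤ k)) → count n (xs ++ ys) ≡ count n xs + count n ys
count-++ n xs ys = trans (cong length (ListP.filter-++ _ xs ys)) (ListP.length-++ (filter _ xs))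

count-map-∷ : ∀ n d (xs : List (Vec ℤ k)) → count n (map (d ∷_) xs) ≡ count (n - d ℤ.* + F (suc k)) xs
count-map-∷ {k} n d xs = begin
  length (filter _ (map (d ∷_) xs))                  ≡⟨ cong length (filter-map _ (d ∷_) xs) ⟩
  length (map (d ∷_) (filter _ xs))                  ≡⟨ ListP.length-map (d ∷_) (filter _ xs) ⟩
  length (filter (λ v → value (d ∷ v) ℤP.≟ n) xs)   ≡⟨ cong length (ListP.filter-≐ _ _ shift xs) ⟩
  count (n - d ℤ.* + F (suc k)) xs                  ∎
  where
  a = d ℤ.* + F (suc k)
  shift : (λ v → value (d ∷ v) ≡ n) ≐ (λ v → value v ≡ n - a)
  shift = (λ {v} → Equivalence.to (+-≡⇔≡-minus a (value v) n)) , (λ {v} → Equivalence.from (+-≡⇔≡-minus a (value v) n))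

count-concat : ∀ n (xss : List (List (Vec ℤ k))) → count n (concat xss) ≡ sum (map (count n) xss)
count-concat n []         = refl
count-concat n (xs ∷ xss) = trans (count-++ n xs (concat xss)) (cong (_+_ (count n xs)) (count-concat n xss))

B-suc : ∀ n k → B n (suc k) ≡ B (n - + F (suc k)) k + B n k + B (n ℤ.+ + F (suc k)) k
B-suc n k = begin
  B n (suc k)
    ≡⟨ count-concat n (map (λ d → map (d ∷_) (allSeqs k)) digits) ⟩
  count n (map (1ℤ ∷_) S) + (count n (map (0ℤ ∷_) S) + (count n (map (- 1ℤ ∷_) S) + 0))
    ≡⟨ cong₂ _+_ (leading 1ℤ (n-1f≡n-f n f)) (cong₂ _+_ (leading 0ℤ (n-0f≡n n f)) (cong (_+ 0) (leading (- 1ℤ) (n+1f≡n+f n f)))) ⟩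
  B (n - f) k + (B n k + (B (n ℤ.+ f) k + 0))
    ≡⟨ a+[b+[c+0]]≡a+b+c (B (n - f) k) (B n k) (B (n ℤ.+ f) k) ⟩
  B (n - f) k + B n k + B (n ℤ.+ f) k ∎
  where
  S = allSeqs k
  f = + F (suc k)
  leading : ∀ d {m} → n - d ℤ.* f ≡ m → count n (map (d ∷_) S) ≡ B m k
  leading d eq = trans (count-map-∷ n d S) (cong (λ m → B m k) eq)
  n-1f≡n-f : ∀ n f → n - 1ℤ ℤ.* f ≡ n - f
  n-1f≡n-f = ℤSolver.solve-∀
  n-0f≡n : ∀ n f → n - 0ℤ ℤ.* f ≡ n
  n-0f≡n = ℤSolver.solve-∀
  n+1f≡n+f : ∀ n f → n - (- 1ℤ) ℤ.* f ≡ n ℤ.+ f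
  n+1f≡n+f = ℤSolver.solve-∀
  a+[b+[c+0]]≡a+b+c : ∀ a b c → a + (b + (c + 0)) ≡ a + b + c
  a+[b+[c+0]]≡a+b+c = ℕSolver.solve-∀

B-neg : ∀ n k → B (- n) k ≡ B n k
B-neg (+ zero)   zero    = refl
B-neg +[1+ m ]   zero    = refl
B-neg -[1+ m ]   zero    = refl
B-neg n          (suc k) = begin
  B (- n) (suc k)                             ≡⟨ B-suc (- n) k ⟩
  B (- n - f) k + B (- n) k + B (- n ℤ.+ f) k ≡⟨ cong₂ _+_ (cong₂ _+_ (B-neg-at (n ℤ.+ f) (-[n+f]≡-n-f n f)) (B-neg n k))
                                                             (B-neg-at (n - f) (-[n-f]≡-n+f n f)) ⟩
  B (n ℤ.+ f) k + B n k + B (n - f) k         ≡⟨ a+b+c≡c+b+a (B (n ℤ.+ f) k) (B n k) (B (n - f) k) ⟩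
  B (n - f) k + B n k + B (n ℤ.+ f) k         ≡⟨ B-suc n k ⟨
  B n (suc k)                                 ∎
  where
  f = + F (suc k)
  B-neg-at : ∀ m {m′} → - m ≡ m′ → B m′ k ≡ B m k
  B-neg-at m eq = trans (cong (λ x → B x k) (sym eq)) (B-neg m k)
  -[n+f]≡-n-f : ∀ n f → - (n ℤ.+ f) ≡ - n - f
  -[n+f]≡-n-f = ℤSolver.solve-∀
  -[n-f]≡-n+f : ∀ n f → - (n - f) ≡ - n ℤ.+ f
  -[n-f]≡-n+f = ℤSolver.solve-∀
  a+b+c≡c+b+a : ∀ a b c → a + b + c ≡ c + b + a
  a+b+c≡c+b+a = ℕSolver.solve-∀

B-beyond : ∀ k {m} → F (suc (suc k)) ≤ m → B (+ m) k ≡ 0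
B-beyond zero    {suc m} _ = refl
B-beyond (suc k) {m}     F[k+3]≤m = begin
  B (+ m) (suc k)                           ≡⟨ B-suc (+ m) k ⟩
  B (+ m - f) k + B (+ m) k + B (+ (m + F (suc k))) k
    ≡⟨ cong₂ _+_ (cong₂ _+_ (trans (cong (λ x → B x k) (pos-minus-pos F[k+1]≤m)) (B-beyond k F[k+2]≤m∸F[k+1]))
                            (B-beyond k F[k+2]≤m))
                 (B-beyond k (ℕP.≤-trans F[k+2]≤m (ℕP.m≤m+n m _))) ⟩
  0                                         ∎
  where
  f = + F (suc k)
  F[k+2]≤m : F (suc (suc k)) ≤ m
  F[k+2]≤m = ℕP.m+n≤o⇒m≤o _ F[k+3]≤m
  F[k+1]≤m : F (suc k) ≤ m
  F[k+1]≤m = ℕP.m+n≤o⇒n≤o _ F[k+3]≤m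
  F[k+2]≤m∸F[k+1] : F (suc (suc k)) ≤ m ∸ F (suc k)
  F[k+2]≤m∸F[k+1] = ℕP.m+n≤o⇒m≤o∸n _ F[k+3]≤m

E : ℕ → ℕ
E k = B (+ F (suc k)) k

B-zero-suc : ∀ k → B 0ℤ (suc k) ≡ B 0ℤ k + 2 * E k
B-zero-suc k = begin
  B 0ℤ (suc k)                               ≡⟨ B-suc 0ℤ k ⟩
  B (0ℤ - f) k + B 0ℤ k + B (0ℤ ℤ.+ f) k     ≡⟨ cong (λ b → b + B 0ℤ k + E k)
                                                     (trans (cong (λ x → B x k) (ℤP.+-identityˡ (- f))) (B-neg f k)) ⟩
  E k + B 0ℤ k + E k                         ≡⟨ e+b+e≡b+2e (E k) (B 0ℤ k) ⟩
  B 0ℤ k + 2 * E k                           ∎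
  where
  f = + F (suc k)
  e+b+e≡b+2e : ∀ e b → e + b + e ≡ b + 2 * e
  e+b+e≡b+2e = ℕSolver.solve-∀

B-F-suc : ∀ k → B (+ F (suc k)) (suc k) ≡ B 0ℤ k + E k
B-F-suc k = begin
  B f (suc k)                                        ≡⟨ B-suc f k ⟩
  B (f - f) k + E k + B (+ (F (suc k) + F (suc k))) k ≡⟨ cong₂ _+_ (cong (λ x → B x k + E k) (ℤP.+-inverseʳ f))
                                                                    (B-beyond k (ℕP.+-monoʳ-≤ (F (suc k)) (F[n]≤F[1+n] k))) ⟩
  B 0ℤ k + E k + 0                                   ≡⟨ ℕP.+-identityʳ _ ⟩
  B 0ℤ k + E k                                       ∎
  where
  f = + F (suc k)

E-suc-suc : ∀ k → E (suc (suc k)) ≡ B (+ F (suc k)) (suc k)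
E-suc-suc k = begin
  E (suc (suc k))                                              ≡⟨ B-suc (+ (a + b)) (suc k) ⟩
  B (+ (a + b) - + a) (suc k) + B (+ (a + b)) (suc k) + B (+ (a + b + a)) (suc k)
    ≡⟨ cong₂ _+_ (cong₂ _+_ (cong (λ x → B x (suc k)) a+b-a≡b) (B-beyond (suc k) ℕP.≤-refl))
                 (B-beyond (suc k) (ℕP.m≤m+n (a + b) a)) ⟩
  B (+ b) (suc k) + 0 + 0                                      ≡⟨ cong (_+ 0) (ℕP.+-identityʳ _) ⟩
  B (+ b) (suc k) + 0                                          ≡⟨ ℕP.+-identityʳ _ ⟩
  B (+ b) (suc k)                                              ∎
  where
  a = F (suc (suc k))
  b = F (suc k)
  a+b-a≡b : + (a + b) - + a ≡ + b
  a+b-a≡b = trans (pos-minus-pos (ℕP.m≤m+n a b)) (cong +_ (ℕP.m+n∸m≡n a b))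

B-zero-recurrence : ∀ k → B 0ℤ (3 + k) ≡ B 0ℤ (2 + k) + B 0ℤ (1 + k) + B 0ℤ k
B-zero-recurrence k = begin
  B 0ℤ (3 + k)                               ≡⟨ B-zero-suc (2 + k) ⟩
  B 0ℤ (2 + k) + 2 * E (2 + k)               ≡⟨ cong (λ e → B 0ℤ (2 + k) + 2 * e) (trans (E-suc-suc k) (B-F-suc k)) ⟩
  B 0ℤ (2 + k) + 2 * (B 0ℤ k + E k)          ≡⟨ a+2[b+e]≡a+[b+2e]+b (B 0ℤ (2 + k)) (B 0ℤ k) (E k) ⟩
  B 0ℤ (2 + k) + (B 0ℤ k + 2 * E k) + B 0ℤ k ≡⟨ cong (λ c → B 0ℤ (2 + k) + c + B 0ℤ k) (B-zero-suc k) ⟨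
  B 0ℤ (2 + k) + B 0ℤ (1 + k) + B 0ℤ k       ∎
  where
  a+2[b+e]≡a+[b+2e]+b : ∀ a b e → a + 2 * (b + e) ≡ a + (b + 2 * e) + b
  a+2[b+e]≡a+[b+2e]+b = ℕSolver.solve-∀

theorem1p1 : ((k : ℕ) → k ≥ 3 → B 0ℤ (suc k) ≡ B 0ℤ k + B 0ℤ (k Data.Nat.∸ 1) + B 0ℤ (k Data.Nat.∸ 2))
    × (B 0ℤ 1 ≡ 1) × (B 0ℤ 2 ≡ 3) × (B 0ℤ 3 ≡ 5)
theorem1p1 = recurrence , refl , refl , refl
  where
  recurrence : (k : ℕ) → k ≥ 3 → B 0ℤ (suc k) ≡ B 0ℤ k + B 0ℤ (k Data.Nat.∸ 1) + B 0ℤ (k Data.Nat.∸ 2)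
  recurrence (suc (suc (suc k))) _ = B-zero-recurrence (suc k)
  recurrence 1 (s≤s ())
  recurrence 2 (s≤s (s≤s ()))
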